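{- Let $\mathcal{N}=\mathbb{N}^{\mathbb{N}}$ be the Baire space and let $X=\{\alpha\in\mathcal{N} : \alpha(0)>0\}$. If $E\subseteq X\times X$ is an analytic ($\boldsymbol{\Sigma}^1_1$) equivalence relation on $X$, then there are equivalence relations $I$ and $J$ on $\mathcal{N}$ (i.e. $I,J\subseteq\mathcal{N}\times\mathcal{N}$), each of which has a closed graph in $\mathcal{N}\times\mathcal{N}$, such that $E=\operatorname{tc}(I\cup J)\cap(X\times X)$.
   Context: $\mathbb{N}=\{0,1,2,\dots\}$ and $\mathcal{N}=\mathbb{N}^{\mathbb{N}}$ carries the product topology of discrete spaces. For a relation $R\subseteq \Omega\times\Omega$, define $R^{(1)}=R$ and $R^{(n+1)}=R\circ R^{(n)}$ (composition of relations), and the transitive closure $\operatorname{tc}(R)=\bigcup_{n\ge 1}R^{(n)}$. A subset of $X\times X$ is analytic if it is analytic as a subset of $\mathcal{N}\times\mathcal{N}$ (equivalently, of the Polish space $X\times X$). -}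

module Defs where

open import Data.Nat using (ℕ; zero; suc; _<_)
open import Data.Bool using (Bool; true)
open import Data.Vec using (Vec; []; _∷_)
open import Data.Product using (Σ; _×_)
open import Data.Sum using (_⊎_)
open import Relation.Binary.PropositionalEquality using (_≡_)
open import Function.Bundles using (_⇔_)

𝒩 : Set
𝒩 = ℕ → ℕ

BRel : Set₁
BRel = 𝒩 → 𝒩 → Set

X : 𝒩 → Set
X α = 0 < α 0

restrict : 𝒩 → (n : ℕ) → Vec ℕ n
restrict α zero = []
restrict α (suc n) = α 0 ∷ restrict (λ k → α (suc k)) n

-- R ⊆ 𝒩 × 𝒩 has closed graph: R = [T] is the set of branches of a
-- (decidable) tree T on ℕ × ℕ, i.e. (x , y) ∈ R iff every finite
-- restriction of (x , y) passes T.
ClosedGraph : BRel → Set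
ClosedGraph R =
  Σ ((n : ℕ) → Vec ℕ n → Vec ℕ n → Bool) λ T →
    ∀ x y → R x y ⇔ (∀ n → T n (restrict x n) (restrict y n) ≡ true)

-- R ⊆ 𝒩 × 𝒩 is analytic (Σ¹₁): projection of a closed subset of
-- 𝒩 × 𝒩 × 𝒩, the closed set given as the branches of a decidable tree.
Analytic : BRel → Set
Analytic R =
  Σ ((n : ℕ) → Vec ℕ n → Vec ℕ n → Vec ℕ n → Bool) λ T →
    ∀ x y → R x y ⇔
      Σ 𝒩 (λ z → ∀ n → T n (restrict x n) (restrict y n) (restrict z n) ≡ true)

IsEquivOn𝒩 : BRel → Set
IsEquivOn𝒩 R =
  (∀ x → R x x) × (∀ x y → R x y → R y x) × (∀ x y z → R x y → R y z → R x z)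

IsEquivOnX : BRel → Set
IsEquivOnX E =
  (∀ x y → E x y → X x × X y) ×
  (∀ x → X x → E x x) ×
  (∀ x y → E x y → E y x) ×
  (∀ x y z → E x y → E y z → E x z)

_∪_ : BRel → BRel → BRel
(R ∪ S) x y = R x y ⊎ S x y

_∘ᵣ_ : BRel → BRel → BRel
(R ∘ᵣ S) x z = Σ 𝒩 λ y → S x y × R y z

-- pow R n = R^(n+1):  R^(1) = R,  R^(n+1) = R ∘ R^(n)
pow : BRel → ℕ → BRel
pow R zero = R
pow R (suc n) = R ∘ᵣ pow R n

tc : BRel → BRel
tc R x y = Σ ℕ λ n → pow R n x y

module Submission where

-- Points with α(0) > 0 are "real"; a point u with u(0) = 0 is "auxiliary" and
-- codes a selector s = u(1) and three sequences a, b, c (interleaved in u from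
-- position 2 on).  Fix a tree T with  x E y ⟺ ∃ z, (x, y, z) ∈ [T].  Both I and
-- J are kernels  u ~ v ⟺ Φ u = Φ v  of maps Φ : 𝒩 → 𝒩 with a continuity
-- modulus; such kernels are closed equivalence relations (ker-closed-equiv).
--   * I: a real point u is sent to suc ∘ u; an auxiliary point is sent to
--     suc ∘ (a or b, according to s) along the prefix where (a, b, c) stays
--     in T, and to 0 afterwards.
--   * J: forgets the selector of auxiliary points.
-- If x E y with witness z, then x I (0, 0, x, y, z) J (0, 1, x, y, z) I y.
-- Conversely the predicate "φI u = suc ∘ w for some w with x E w" holds at
-- a real x and is invariant under I- and J-steps, which yields E on X.

open import Defs
open import Data.Product using (Σ; _×_; _,_; proj₁; proj₂)
open import Function.Bundles using (_⇔_; mk⇔; Equivalence)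
open import Data.Nat using (ℕ; zero; suc; _+_; _≤_; _<_; z≤n; s≤s; _≡ᵇ_; _≤ᵇ_; _≟_)
open import Data.Nat.Properties
  using (≡ᵇ⇒≡; ≡⇒≡ᵇ; ≤ᵇ⇒≤; ≤⇒≤ᵇ; ≤-refl; ≤-trans; <-≤-trans; <⇒≤; m≤m+n; m≤n+m; n≤1+n;
         +-mono-≤; m≤n⇒m<n∨m≡n; suc-injective; n≢0⇒n>0)
open import Data.Bool using (Bool; true; false; T; if_then_else_; _∧_)
open import Data.Bool.Properties using (T-≡; T-∧)
open import Data.Vec using (Vec; []; _∷_)
open import Data.Sum using (inj₁; inj₂)
open import Relation.Nullary using (yes; no)
open import Relation.Binary.PropositionalEquality using (_≡_; refl; sym; trans; cong; cong₂; subst)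

Agree : ℕ → 𝒩 → 𝒩 → Set
Agree m u u' = ∀ i → i < m → u i ≡ u' i

restrict-cong : ∀ m u u' → Agree m u u' → restrict u m ≡ restrict u' m
restrict-cong zero u u' ag = refl
restrict-cong (suc m) u u' ag = cong₂ _∷_ (ag 0 (s≤s z≤n))
  (restrict-cong m (λ k → u (suc k)) (λ k → u' (suc k)) (λ i p → ag (suc i) (s≤s p)))

extend : ∀ {n} → Vec ℕ n → 𝒩
extend [] i = 0
extend (x ∷ xs) zero = x
extend (x ∷ xs) (suc i) = extend xs i

extend-restrict : ∀ n u → Agree n (extend (restrict u n)) u
extend-restrict zero u i ()
extend-restrict (suc n) u zero p = refl
extend-restrict (suc n) u (suc i) (s≤s p) = extend-restrict n (λ k → u (suc k)) i p

analytic-ext : ∀ {R} → Analytic R → ∀ {a a' b b'} → R a b →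
  (∀ k → a k ≡ a' k) → (∀ k → b k ≡ b' k) → R a' b'
analytic-ext (tr , R⇔) {a} {a'} {b} {b'} r pa pb with Equivalence.to (R⇔ a b) r
... | z , inT = Equivalence.from (R⇔ a' b') (z , λ n →
      trans (cong₂ (λ U V → tr n U V (restrict z n))
                   (restrict-cong n a' a (λ i _ → sym (pa i)))
                   (restrict-cong n b' b (λ i _ → sym (pb i))))
            (inT n))

Ker : (𝒩 → 𝒩) → BRel
Ker Φ u v = ∀ k → Φ u k ≡ Φ v k

ker-equiv : ∀ Φ → IsEquivOn𝒩 (Ker Φ)
ker-equiv Φ = (λ u k → refl) , (λ u v p k → sym (p k)) , (λ u v w p q k → trans (p k) (q k))

HasModulus : (𝒩 → 𝒩) → (ℕ → ℕ) → Set
HasModulus Φ g = ∀ u u' k → Agree (g k) u u' → Φ u k ≡ Φ u' k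

modulus-ext : ∀ {Φ g} → HasModulus Φ g → ∀ {u v} → (∀ i → u i ≡ v i) → Ker Φ u v
modulus-ext mod {u} {v} p k = mod u v k (λ i _ → p i)

allBelow : (ℕ → Bool) → ℕ → Bool
allBelow p zero = true
allBelow p (suc m) = allBelow p m ∧ p m

allBelow-intro : ∀ p → (∀ k → T (p k)) → ∀ m → T (allBelow p m)
allBelow-intro p h zero = _
allBelow-intro p h (suc m) = Equivalence.from T-∧ (allBelow-intro p h m , h m)

allBelow-elim : ∀ p m k → k < m → T (allBelow p m) → T (p k)
allBelow-elim p (suc m) k (s≤s k≤m) h with m≤n⇒m<n∨m≡n k≤m
... | inj₁ k<m = allBelow-elim p m k k<m (proj₁ (Equivalence.to T-∧ h))
... | inj₂ refl = proj₂ (Equivalence.to T-∧ h)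

module KernelClosed (Φ : 𝒩 → 𝒩) (g : ℕ → ℕ) (mod : HasModulus Φ g) where

  coord : (n : ℕ) → Vec ℕ n → Vec ℕ n → ℕ → Bool
  coord n U V k = if g k ≤ᵇ n then Φ (extend U) k ≡ᵇ Φ (extend V) k else true

  tree : (n : ℕ) → Vec ℕ n → Vec ℕ n → Bool
  tree n U V = allBelow (coord n U V) n

  extend-correct : ∀ u n k → g k ≤ n → Φ (extend (restrict u n)) k ≡ Φ u k
  extend-correct u n k le = mod _ _ k (λ i p → extend-restrict n u i (<-≤-trans p le))

  coord-sound : ∀ u v → Ker Φ u v → ∀ n k → T (coord n (restrict u n) (restrict v n) k)
  coord-sound u v h n k with g k ≤ᵇ n in eq
  ... | false = _
  ... | true = ≡⇒≡ᵇ _ _ (trans (extend-correct u n k le) (trans (h k) (sym (extend-correct v n k le))))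
    where le = ≤ᵇ⇒≤ (g k) n (subst T (sym eq) _)

  coord-complete : ∀ n U V k → g k ≤ n → T (coord n U V k) → Φ (extend U) k ≡ Φ (extend V) k
  coord-complete n U V k le c with g k ≤ᵇ n | ≤⇒≤ᵇ le
  ... | true | _ = ≡ᵇ⇒≡ _ _ c

  -- Coordinate k is checked at level 1 + k + g k.
  branch⇒ker : ∀ u v → (∀ n → tree n (restrict u n) (restrict v n) ≡ true) → Ker Φ u v
  branch⇒ker u v h k =
    trans (sym (extend-correct u n k g≤n)) (trans agreeAt-n (extend-correct v n k g≤n))
    where
    n : ℕ
    n = suc (k + g k)
    g≤n : g k ≤ n
    g≤n = ≤-trans (m≤n+m (g k) k) (n≤1+n _)
    agreeAt-n : Φ (extend (restrict u n)) k ≡ Φ (extend (restrict v n)) k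
    agreeAt-n = coord-complete n (restrict u n) (restrict v n) k g≤n
      (allBelow-elim _ n k (s≤s (m≤m+n k (g k))) (Equivalence.from T-≡ (h n)))

  closed : ClosedGraph (Ker Φ)
  closed = tree , λ u v → mk⇔
    (λ h n → Equivalence.to T-≡ (allBelow-intro _ (coord-sound u v h n) n))
    (branch⇒ker u v)

ker-closed-equiv : ∀ Φ g → HasModulus Φ g → IsEquivOn𝒩 (Ker Φ) × ClosedGraph (Ker Φ)
ker-closed-equiv Φ g mod = ker-equiv Φ , KernelClosed.closed Φ g mod

pow-preserves : ∀ (R : BRel) (P : 𝒩 → Set) → (∀ u v → R u v → P u → P v) →
  ∀ n u v → pow R n u v → P u → P v
pow-preserves R P step zero u v r pu = step u v r pu
pow-preserves R P step (suc n) u v (m , r* , r) pu =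
  step m v r (pow-preserves R P step n u m r* pu)

tc-preserves : ∀ (R : BRel) (P : 𝒩 → Set) → (∀ u v → R u v → P u → P v) →
  ∀ u v → tc R u v → P u → P v
tc-preserves R P step u v (n , r) = pow-preserves R P step n u v r

-- Layout of auxiliary points: tag 0 at position 0, selector at position 1,
-- and three sequences interleaved from position 2 on, at stride three.
thrice : ℕ → ℕ
thrice zero = 0
thrice (suc i) = suc (suc (suc (thrice i)))

thrice-mono : ∀ {i k} → i ≤ k → thrice i ≤ thrice k
thrice-mono z≤n = z≤n
thrice-mono (s≤s p) = s≤s (s≤s (s≤s (thrice-mono p)))

n≤thrice : ∀ n → n ≤ thrice n
n≤thrice zero = z≤n
n≤thrice (suc n) = s≤s (≤-trans (n≤thrice n) (m≤n+m (thrice n) 2))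

slot : ℕ → 𝒩 → 𝒩
slot j u i = u (2 + (j + thrice i))

Aₛ Bₛ Zₛ : 𝒩 → 𝒩
Aₛ = slot 0
Bₛ = slot 1
Zₛ = slot 2

interleave : 𝒩 → 𝒩 → 𝒩 → 𝒩
interleave a b c zero = a 0
interleave a b c (suc zero) = b 0
interleave a b c (suc (suc zero)) = c 0
interleave a b c (suc (suc (suc n))) =
  interleave (λ k → a (suc k)) (λ k → b (suc k)) (λ k → c (suc k)) n

code : ℕ → 𝒩 → 𝒩 → 𝒩 → 𝒩
code s a b c zero = 0
code s a b c (suc zero) = s
code s a b c (suc (suc n)) = interleave a b c n

code-A : ∀ s a b c i → Aₛ (code s a b c) i ≡ a i
code-A s a b c zero = refl
code-A s a b c (suc i) = code-A s (λ k → a (suc k)) (λ k → b (suc k)) (λ k → c (suc k)) i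

code-B : ∀ s a b c i → Bₛ (code s a b c) i ≡ b i
code-B s a b c zero = refl
code-B s a b c (suc i) = code-B s (λ k → a (suc k)) (λ k → b (suc k)) (λ k → c (suc k)) i

code-Z : ∀ s a b c i → Zₛ (code s a b c) i ≡ c i
code-Z s a b c zero = refl
code-Z s a b c (suc i) = code-Z s (λ k → a (suc k)) (λ k → b (suc k)) (λ k → c (suc k)) i

-- The modulus used for I: slots up to index k lie below 5 + 3k.
modI : ℕ → ℕ
modI k = 5 + thrice k

slot-index< : ∀ j {i k} → j ≤ 2 → i ≤ k → 2 + (j + thrice i) < modI k
slot-index< j j≤2 i≤k = s≤s (s≤s (s≤s (+-mono-≤ j≤2 (thrice-mono i≤k))))

slot-agree : ∀ j {u u' k} → j ≤ 2 → Agree (modI k) u u' → ∀ i → i ≤ k → slot j u i ≡ slot j u' i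
slot-agree j j≤2 ag i i≤k = ag _ (slot-index< j j≤2 i≤k)

choose : ℕ → 𝒩 → 𝒩 → 𝒩
choose zero a b = a
choose (suc _) a b = b

choose-at : ∀ s {a a' b b'} k → a k ≡ a' k → b k ≡ b' k → choose s a b k ≡ choose s a' b' k
choose-at zero k pa pb = pa
choose-at (suc _) k pa pb = pb

sel : 𝒩 → 𝒩
sel u = choose (u 1) (Aₛ u) (Bₛ u)

sel-mod : ∀ u u' k → Agree (modI k) u u' → sel u k ≡ sel u' k
sel-mod u u' k ag =
  trans (cong (λ s → choose s (Aₛ u) (Bₛ u) k) (ag 1 (s≤s (s≤s z≤n))))
        (choose-at (u' 1) k (slot-agree 0 z≤n ag k ≤-refl) (slot-agree 1 (s≤s z≤n) ag k ≤-refl))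

switch-choice : ∀ {E} → IsEquivOnX E → ∀ {x a b} s → E x (choose s a b) → E a b →
  ∀ s' → E x (choose s' a b)
switch-choice eqv zero xa ab zero = xa
switch-choice (_ , _ , _ , transE) zero xa ab (suc _) = transE _ _ _ xa ab
switch-choice (_ , _ , symE , transE) (suc _) xb ab zero = transE _ _ _ xb (symE _ _ ab)
switch-choice eqv (suc _) xb ab (suc _) = xb

Tree3 : Set
Tree3 = (n : ℕ) → Vec ℕ n → Vec ℕ n → Vec ℕ n → Bool

module Construction (TE : Tree3) where

  inTree : 𝒩 → 𝒩 → 𝒩 → ℕ → Bool
  inTree a b c k = TE k (restrict a k) (restrict b k) (restrict c k)

  inTree-cong : ∀ {a a' b b' c c'} k → Agree k a a' → Agree k b b' → Agree k c c' →
    inTree a b c k ≡ inTree a' b' c' k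
  inTree-cong {a} {a'} {b} {b'} {c} {c'} k pa pb pc =
    trans (cong₂ (λ A B → TE k A B (restrict c k)) (restrict-cong k a a' pa) (restrict-cong k b b' pb))
          (cong (TE k (restrict a' k) (restrict b' k)) (restrict-cong k c c' pc))

  ok : 𝒩 → ℕ → Bool
  ok u = inTree (Aₛ u) (Bₛ u) (Zₛ u)

  auxValue : 𝒩 → 𝒩
  auxValue u k = if ok u k then suc (sel u k) else 0

  φI' : ℕ → 𝒩 → 𝒩
  φI' zero u = auxValue u
  φI' (suc _) u k = suc (u k)

  φI : 𝒩 → 𝒩
  φI u = φI' (u 0) u

  keepSel : ℕ → ℕ → ℕ
  keepSel zero _ = 0
  keepSel (suc _) s = s

  φJ : 𝒩 → 𝒩
  φJ u zero = u 0
  φJ u (suc zero) = keepSel (u 0) (u 1)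
  φJ u (suc (suc k)) = u (suc (suc k))

  I J : BRel
  I = Ker φI
  J = Ker φJ

  φI'-mod : ∀ t u u' k → Agree (modI k) u u' → φI' t u k ≡ φI' t u' k
  φI'-mod zero u u' k ag = cong₂ (λ b s → if b then suc s else 0)
    (inTree-cong k (λ i p → slot-agree 0 z≤n ag i (<⇒≤ p))
                   (λ i p → slot-agree 1 (s≤s z≤n) ag i (<⇒≤ p))
                   (λ i p → slot-agree 2 (s≤s (s≤s z≤n)) ag i (<⇒≤ p)))
    (sel-mod u u' k ag)
  φI'-mod (suc _) u u' k ag = cong suc (ag k (s≤s (≤-trans (n≤thrice k) (m≤n+m _ 4))))

  φI-mod : HasModulus φI modI
  φI-mod u u' k ag = trans (cong (λ t → φI' t u k) (ag 0 (s≤s z≤n))) (φI'-mod (u' 0) u u' k ag)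

  φJ-mod : HasModulus φJ suc
  φJ-mod u u' zero ag = ag 0 (s≤s z≤n)
  φJ-mod u u' (suc zero) ag = cong₂ keepSel (ag 0 (s≤s z≤n)) (ag 1 (s≤s (s≤s z≤n)))
  φJ-mod u u' (suc (suc k)) ag = ag _ ≤-refl

  φI-real : ∀ u k → 0 < u 0 → φI u k ≡ suc (u k)
  φI-real u k p with u 0 | p
  ... | suc _ | _ = refl

  φI-aux : ∀ u k → u 0 ≡ 0 → φI u k ≡ auxValue u k
  φI-aux u k tag = cong (λ t → φI' t u k) tag

  auxValue-suc : ∀ u k w → auxValue u k ≡ suc w → (ok u k ≡ true) × (sel u k ≡ w)
  auxValue-suc u k w eq with ok u k
  auxValue-suc u k w refl | true = refl , refl

  keepSel-real : ∀ {t t' s s'} → 0 < t → t ≡ t' → keepSel t s ≡ keepSel t' s' → s ≡ s'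
  keepSel-real {suc _} _ refl e = e

  -- On real points J is equality, hence J ⊆ I there.
  J-real⇒I : ∀ u v → J u v → 0 < u 0 → I u v
  J-real⇒I u v j p = modulus-ext φI-mod same
    where
    same : ∀ i → u i ≡ v i
    same zero = j 0
    same (suc zero) = keepSel-real p (j 0) (j 1)
    same (suc (suc i)) = j (suc (suc i))

module ForRelation (E : BRel) (eqv : IsEquivOnX E) (an : Analytic E) where
  open Construction (proj₁ an)

  E-ext : ∀ {a a' b b'} → E a b → (∀ k → a k ≡ a' k) → (∀ k → b k ≡ b' k) → E a' b'
  E-ext = analytic-ext {E} an

  valid⇒E : ∀ u → (∀ k → ok u k ≡ true) → E (Aₛ u) (Bₛ u)
  valid⇒E u h = Equivalence.from (proj₂ an _ _) (Zₛ u , h)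

  Shows : 𝒩 → 𝒩 → Set
  Shows x u = Σ 𝒩 λ w → E x w × (∀ k → φI u k ≡ suc (w k))

  shows-I : ∀ x u v → I u v → Shows x u → Shows x v
  shows-I x u v i (w , e , h) = w , e , λ k → trans (sym (i k)) (h k)

  -- A J-step between auxiliary points changes only the selector; since the
  -- source displays an E-relative of x and is valid, both slots are
  -- E-relatives of x, so the target displays one as well.
  shows-J-aux : ∀ x u v → J u v → u 0 ≡ 0 → Shows x u → Shows x v
  shows-J-aux x u v j tag (w , e , h) = sel v , x-sel-v , shows-sel-v
    where
    displayed : ∀ k → (ok u k ≡ true) × (sel u k ≡ w k)
    displayed k = auxValue-suc u k (w k) (trans (sym (φI-aux u k tag)) (h k))
    slots : ∀ n i → slot n v i ≡ slot n u i
    slots n i = sym (j (2 + (n + thrice i)))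
    ok-v : ∀ k → ok v k ≡ true
    ok-v k = trans (inTree-cong k (λ i _ → slots 0 i) (λ i _ → slots 1 i) (λ i _ → slots 2 i))
                   (proj₁ (displayed k))
    x-sel-u : E x (sel u)
    x-sel-u = E-ext e (λ _ → refl) (λ k → sym (proj₂ (displayed k)))
    x-chosen : ∀ s → E x (choose s (Aₛ u) (Bₛ u))
    x-chosen = switch-choice eqv (u 1) x-sel-u (valid⇒E u (λ k → proj₁ (displayed k)))
    x-sel-v : E x (sel v)
    x-sel-v = E-ext (x-chosen (v 1)) (λ _ → refl)
      (λ k → choose-at (v 1) k (sym (slots 0 k)) (sym (slots 1 k)))
    shows-sel-v : ∀ k → φI v k ≡ suc (sel v k)
    shows-sel-v k rewrite φI-aux v k (trans (sym (j 0)) tag) | ok-v k = refl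

  -- Shows x is invariant under I ∪ J: J-steps from real points are I-steps.
  shows-step : ∀ x u v → (I ∪ J) u v → Shows x u → Shows x v
  shows-step x u v (inj₁ i) s = shows-I x u v i s
  shows-step x u v (inj₂ j) s with u 0 ≟ 0
  ... | yes aux = shows-J-aux x u v j aux s
  ... | no real = shows-I x u v (J-real⇒I u v j (n≢0⇒n>0 real)) s

  -- A real x shows itself, and a real y showing w forces w = y.
  tc⇒E : ∀ x y → tc (I ∪ J) x y × (X x × X y) → E x y
  tc⇒E x y (path , x∈X , y∈X)
    with tc-preserves (I ∪ J) (Shows x) (shows-step x) x y path
           (x , proj₁ (proj₂ eqv) x x∈X , λ k → φI-real x k x∈X)
  ... | w , e , h = E-ext e (λ _ → refl) (λ k → suc-injective (trans (sym (h k)) (φI-real y k y∈X)))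

  module Bridge (x y z : 𝒩) (h : ∀ n → inTree x y z n ≡ true) where
    bridge : ℕ → 𝒩
    bridge s = code s x y z

    bridge-ok : ∀ s k → ok (bridge s) k ≡ true
    bridge-ok s k = trans (inTree-cong k (λ i _ → code-A s x y z i) (λ i _ → code-B s x y z i)
                                         (λ i _ → code-Z s x y z i))
                          (h k)

    bridge-x : ∀ k → φI (bridge 0) k ≡ suc (x k)
    bridge-x k rewrite bridge-ok 0 k = cong suc (code-A 0 x y z k)

    bridge-y : ∀ k → φI (bridge 1) k ≡ suc (y k)
    bridge-y k rewrite bridge-ok 1 k = cong suc (code-B 1 x y z k)

    bridge-J : J (bridge 0) (bridge 1)
    bridge-J zero = refl
    bridge-J (suc zero) = refl
    bridge-J (suc (suc k)) = refl

  -- x I bridge 0 J bridge 1 I y.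
  E⇒tc : ∀ x y → E x y → tc (I ∪ J) x y × (X x × X y)
  E⇒tc x y e with Equivalence.to (proj₂ an x y) e | proj₁ eqv x y e
  ... | z , h | x∈X , y∈X =
    (2 , bridge 1 , (bridge 0 , inj₁ x-I-b0 , inj₂ bridge-J) , inj₁ b1-I-y) , x∈X , y∈X
    where
    open Bridge x y z h
    x-I-b0 : I x (bridge 0)
    x-I-b0 k = trans (φI-real x k x∈X) (sym (bridge-x k))
    b1-I-y : I (bridge 1) y
    b1-I-y k = trans (bridge-y k) (sym (φI-real y k y∈X))

theorem1 : (E : BRel) → IsEquivOnX E → Analytic E →
    Σ BRel λ I → Σ BRel λ J →
    IsEquivOn𝒩 I × ClosedGraph I × IsEquivOn𝒩 J × ClosedGraph J ×
    (∀ x y → E x y ⇔ (tc (I ∪ J) x y × (X x × X y)))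
theorem1 E eqv an =
  I , J , proj₁ I-closed , proj₂ I-closed , proj₁ J-closed , proj₂ J-closed ,
  λ x y → mk⇔ (E⇒tc x y) (tc⇒E x y)
  where
  open ForRelation E eqv an
  open Construction (proj₁ an)
  I-closed : IsEquivOn𝒩 I × ClosedGraph I
  I-closed = ker-closed-equiv φI modI φI-mod
  J-closed : IsEquivOn𝒩 J × ClosedGraph J
  J-closed = ker-closed-equiv φJ suc φJ-mod
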